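{- Suppose the parameters (functions of $n$) satisfy $D = O(\Delta)$, $n/\delta = o(N_1)$, and $M = o(\delta \cdot K \cdot N_1)$. Then there exists a table $E : [N] \times [N_1] \to [M]$ that is $(K, D, \Delta)$-balanced.
   Context: Write $N = 2^n$, $N_1 = 2^{n_1}$, $M = 2^m$, $K = 2^k$, $D = 2^d$, $\Delta = 2^\delta$, where $n_1, m, k, d, \delta$ are functions of $n$; asymptotic notation is as $n \to \infty$. A table $E : [N] \times [N_1] \to [M]$ is an $[N]$-by-$[N_1]$ array colored with colors from $[M]$; for $A \subseteq [M]$, a cell $(u,v)$ is an $A$-cell if $E(u,v) \in A$. $E$ is $(K,D,\Delta)$-balanced if for every $B \subseteq [N]$ with $|B| \geq K$ and every $A \subseteq [M]$ with $|A|/M \geq 1/D$, the number of $A$-cells in $B \times [N_1]$ is at most $\Delta \cdot \frac{|A|}{M} \cdot |B| \cdot N_1$. -}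

module Defs where

open import Data.Nat using (ℕ; _+_; _*_; _^_; _≤_)
open import Data.Fin using (Fin)
open import Data.Fin.Subset using (Subset; ∣_∣)
open import Data.Vec using (lookup)
open import Data.List using (map; allFin)
open import Data.Nat.ListAction using (sum)
open import Data.Bool using (if_then_else_)
open import Data.Product using (∃; Σ)

Table : ℕ → ℕ → ℕ → Set
Table N N₁ M = Fin N → Fin N₁ → Fin M

countCells : ∀ {N N₁ M} → Table N N₁ M → Subset N → Subset M → ℕ
countCells {N} {N₁} E B A =
  sum (map (λ u → if lookup B u
                  then sum (map (λ v → if lookup A (E u v) then 1 else 0) (allFin N₁))
                  else 0)
           (allFin N))

-- (K, D, Δ)-balanced:  for all B with |B| ≥ K and A with |A|/M ≥ 1/D,
--   #A-cells in B × [N₁] ≤ Δ · (|A|/M) · |B| · N₁   (cleared of denominators)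
Balanced : ∀ {N N₁ M} → (K D Δ : ℕ) → Table N N₁ M → Set
Balanced {N} {N₁} {M} K D Δ E =
  (B : Subset N) (A : Subset M) → K ≤ ∣ B ∣ → M ≤ D * ∣ A ∣ →
  M * countCells E B A ≤ Δ * ∣ A ∣ * ∣ B ∣ * N₁

BigO : (ℕ → ℕ) → (ℕ → ℕ) → Set
BigO f g = ∃ λ C → ∃ λ n₀ → ∀ n → n₀ ≤ n → f n ≤ C * g n

LittleO : (ℕ → ℕ) → (ℕ → ℕ) → Set
LittleO f g = ∀ c → ∃ λ n₀ → ∀ n → n₀ ≤ n → c * f n ≤ g n

Eventually : (ℕ → Set) → Set
Eventually P = ∃ λ n₀ → ∀ n → n₀ ≤ n → P n

-- The probabilistic method, by counting. Fix B ⊆ [N] and A ⊆ [M] with |B| = b ≥ K and |A| = a ≥ M/D.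
-- Summing Δ^(number of A-cells in B × [N₁]) over all M^(N N₁) tables gives
-- M^(N N₁) (1 + (Δ-1)a/M)^(b N₁), and (1 + x/M)^M ≤ (256/81)^x for M a power of 2.  By Markov's
-- inequality the tables with more than Δ (a/M) b N₁ such cells are then a fraction at most
-- 2^-(δΔ - 1.8(Δ-1)) a b N₁/M ≤ 2^-(M + 2 + (n+1)b), the growth conditions paying for the exponent.
-- Summing over the 2^M sets A and over all B, using Σ_B (2N)^-|B| = (1 + 1/(2N))^N ≤ 2,
-- at most half of all tables are unbalanced.

module Submission where

open import Data.Bool using (Bool; true; false; if_then_else_)
open import Data.Fin using (Fin; zero; suc)
open import Data.Fin.Subset using (Subset; ∣_∣)
open import Data.List using (List; []; _∷_; _++_; map; allFin; concatMap; tabulate; length)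
open import Data.List.Membership.Propositional using (_∈_; lose)
open import Data.List.Membership.Propositional.Properties using (∈-map⁺; ∈-concatMap⁺)
open import Data.List.Properties using (map-cong; map-∘; map-++; map-tabulate; tabulate-cong; length-tabulate)
open import Data.List.Relation.Unary.Any using (here; there)
open import Data.Nat
open import Data.Nat.DivMod using (_/_; _%_; m≡m%n+[m/n]*n; m%n<n; m<n*o⇒m/o<n)
open import Data.Nat.ListAction using (sum; product)
open import Data.Nat.ListAction.Properties using (sum-++)
open import Data.Nat.Properties
open import Algebra.Properties.CommutativeSemigroup *-commutativeSemigroup
  using (x∙yz≈y∙xz; x∙yz≈xz∙y; xy∙z≈xz∙y; interchange)
open import Data.Nat.Tactic.RingSolver using (solve-∀)
open import Data.Product using (Σ; ∃; _×_; _,_; proj₁; proj₂)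
open import Data.Vec using (Vec; []; _∷_; lookup)
open import Function using (_∘_)
open import Relation.Binary.PropositionalEquality
open import Relation.Nullary using (Dec; yes; no; ¬_; contradiction)
open import Relation.Nullary.Decidable using (_×-dec_)

open import Defs

private variable
  U V : Set

sum-map-cong : ∀ {f g : U → ℕ} (xs : List U) → (∀ x → f x ≡ g x) → sum (map f xs) ≡ sum (map g xs)
sum-map-cong xs f≗g = cong sum (map-cong f≗g xs)

sum-map-mono : ∀ {f g : U → ℕ} (xs : List U) → (∀ x → f x ≤ g x) → sum (map f xs) ≤ sum (map g xs)
sum-map-mono []       f≤g = z≤n
sum-map-mono (x ∷ xs) f≤g = +-mono-≤ (f≤g x) (sum-map-mono xs f≤g)

sum-map-*ˡ : ∀ c (f : U → ℕ) xs → sum (map (λ x → c * f x) xs) ≡ c * sum (map f xs)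
sum-map-*ˡ c f []       = sym (*-zeroʳ c)
sum-map-*ˡ c f (x ∷ xs) = trans (cong (c * f x +_) (sum-map-*ˡ c f xs))
                                (sym (*-distribˡ-+ c (f x) (sum (map f xs))))

sum-map-*ʳ : ∀ c (f : U → ℕ) xs → sum (map (λ x → f x * c) xs) ≡ sum (map f xs) * c
sum-map-*ʳ c f xs = trans (sum-map-cong xs (λ x → *-comm (f x) c))
                          (trans (sum-map-*ˡ c f xs) (*-comm c _))

sum-map-const : ∀ c (xs : List U) → sum (map (λ _ → c) xs) ≡ c * length xs
sum-map-const c []       = sym (*-zeroʳ c)
sum-map-const c (x ∷ xs) = trans (cong (c +_) (sum-map-const c xs)) (sym (*-suc c (length xs)))

sum-map-1 : ∀ (xs : List U) → sum (map (λ _ → 1) xs) ≡ length xs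
sum-map-1 xs = trans (sum-map-const 1 xs) (*-identityˡ (length xs))

sum-map-+ : ∀ (f g : U → ℕ) xs → sum (map (λ x → f x + g x) xs) ≡ sum (map f xs) + sum (map g xs)
sum-map-+ f g []       = refl
sum-map-+ f g (x ∷ xs) = trans (cong (f x + g x +_) (sum-map-+ f g xs))
                               (+-+-comm (f x) (g x) (sum (map f xs)) (sum (map g xs)))
  where
  +-+-comm : ∀ a b c d → a + b + (c + d) ≡ a + c + (b + d)
  +-+-comm = solve-∀

sum-map-swap : ∀ (f : U → V → ℕ) xs ys →
  sum (map (λ x → sum (map (f x) ys)) xs) ≡ sum (map (λ y → sum (map (λ x → f x y) xs)) ys)
sum-map-swap f []       ys = sym (sum-map-const 0 ys)
sum-map-swap f (x ∷ xs) ys = trans (cong (sum (map (f x) ys) +_) (sum-map-swap f xs ys))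
                                   (sym (sum-map-+ (f x) _ ys))

sum-map-concatMap : ∀ (f : V → ℕ) (g : U → List V) xs →
  sum (map f (concatMap g xs)) ≡ sum (map (λ x → sum (map f (g x))) xs)
sum-map-concatMap f g []       = refl
sum-map-concatMap f g (x ∷ xs) = begin
  sum (map f (g x ++ concatMap g xs))           ≡⟨ cong sum (map-++ f (g x) (concatMap g xs)) ⟩
  sum (map f (g x) ++ map f (concatMap g xs))   ≡⟨ sum-++ (map f (g x)) _ ⟩
  sum (map f (g x)) + sum (map f (concatMap g xs)) ≡⟨ cong (sum (map f (g x)) +_) (sum-map-concatMap f g xs) ⟩
  sum (map f (g x)) + sum (map (λ x → sum (map f (g x))) xs) ∎
  where open ≡-Reasoning

sum-map<length⇒zero : ∀ (f : U → ℕ) xs → sum (map f xs) < length xs → ∃ λ x → f x ≡ 0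
sum-map<length⇒zero f (x ∷ xs) fxs<len with f x in fx≡
... | zero  = x , fx≡
... | suc _ = sum-map<length⇒zero f xs (≤-trans (s≤s (m≤n+m _ _)) (≤-pred fxs<len))

sum-map≡0⇒zero : ∀ (f : U → ℕ) {xs} → sum (map f xs) ≡ 0 → ∀ {x} → x ∈ xs → f x ≡ 0
sum-map≡0⇒zero f {y ∷ _} sum≡0 (here refl) = m+n≡0⇒m≡0 (f y) sum≡0
sum-map≡0⇒zero f {y ∷ _} sum≡0 (there x∈) = sum-map≡0⇒zero f (m+n≡0⇒n≡0 (f y) sum≡0) x∈

sum-allFin : ∀ {n} (h : Fin n → ℕ) → sum (map h (allFin n)) ≡ sum (tabulate h)
sum-allFin h = cong sum (map-tabulate (λ i → i) h)

product-tabulate-cong : ∀ {n} {f g : Fin n → ℕ} → (∀ i → f i ≡ g i) →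
  product (tabulate f) ≡ product (tabulate g)
product-tabulate-cong f≗g = cong product (tabulate-cong f≗g)

product-tabulate-const : ∀ n x → product (tabulate {n = n} (λ _ → x)) ≡ x ^ n
product-tabulate-const zero    x = refl
product-tabulate-const (suc n) x = cong (x *_) (product-tabulate-const n x)

^-sum-tabulate : ∀ x {n} (h : Fin n → ℕ) → x ^ sum (tabulate h) ≡ product (tabulate (λ i → x ^ h i))
^-sum-tabulate x {zero}  h = refl
^-sum-tabulate x {suc n} h = trans (^-distribˡ-+-* x (h zero) _) (cong (x ^ h zero *_) (^-sum-tabulate x (h ∘ suc)))

allVecs : ∀ n → List U → List (Vec U n)
allVecs zero    xs = [] ∷ []
allVecs (suc n) xs = concatMap (λ x → map (x ∷_) (allVecs n xs)) xs

∈-allVecs : ∀ {n} xs (v : Vec U n) → (∀ i → lookup v i ∈ xs) → v ∈ allVecs n xs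
∈-allVecs xs []      _    = here refl
∈-allVecs xs (x ∷ v) v⊆xs =
  ∈-concatMap⁺ _ (lose (v⊆xs zero) (∈-map⁺ (x ∷_) (∈-allVecs xs v (v⊆xs ∘ suc))))

sum-allVecs-product : ∀ n (g : Fin n → U → ℕ) xs →
  sum (map (λ v → product (tabulate (λ i → g i (lookup v i)))) (allVecs n xs))
    ≡ product (tabulate (λ i → sum (map (g i) xs)))
sum-allVecs-product zero    g xs = refl
sum-allVecs-product (suc n) g xs = begin
  sum (map term (concatMap (λ x → map (x ∷_) (allVecs n xs)) xs))
    ≡⟨ sum-map-concatMap term _ xs ⟩
  sum (map (λ x → sum (map term (map (x ∷_) (allVecs n xs)))) xs)
    ≡⟨ sum-map-cong xs (λ x → trans (cong sum (sym (map-∘ (allVecs n xs))))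
                                    (sum-map-*ˡ (g zero x) tail (allVecs n xs))) ⟩
  sum (map (λ x → g zero x * sum (map tail (allVecs n xs))) xs)
    ≡⟨ sum-map-*ʳ _ (g zero) xs ⟩
  sum (map (g zero) xs) * sum (map tail (allVecs n xs))
    ≡⟨ cong (sum (map (g zero) xs) *_) (sum-allVecs-product n (g ∘ suc) xs) ⟩
  product (tabulate (λ i → sum (map (g i) xs))) ∎
  where
  open ≡-Reasoning
  term : Vec _ (suc n) → ℕ
  term v = product (tabulate (λ i → g i (lookup v i)))
  tail : Vec _ n → ℕ
  tail v = product (tabulate (λ i → g (suc i) (lookup v i)))

length-allVecs : ∀ n (xs : List U) → length (allVecs n xs) ≡ length xs ^ n
length-allVecs n xs = begin
  length (allVecs n xs)                                         ≡⟨ sym (sum-map-1 (allVecs n xs)) ⟩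
  sum (map (λ _ → 1) (allVecs n xs))                            ≡⟨ sum-map-cong (allVecs n xs) (λ _ → sym ∏1≡1) ⟩
  sum (map (λ _ → product (tabulate {n = n} (λ _ → 1))) (allVecs n xs))
                                                                ≡⟨ sum-allVecs-product n (λ _ _ → 1) xs ⟩
  product (tabulate {n = n} (λ _ → sum (map (λ _ → 1) xs)))     ≡⟨ product-tabulate-const n _ ⟩
  sum (map (λ _ → 1) xs) ^ n                                    ≡⟨ cong (_^ n) (sum-map-1 xs) ⟩
  length xs ^ n                                                 ∎
  where
  open ≡-Reasoning
  ∏1≡1 : product (tabulate {n = n} (λ _ → 1)) ≡ 1
  ∏1≡1 = trans (product-tabulate-const n 1) (^-zeroˡ n)

allSubsets : ∀ n → List (Subset n)
allSubsets n = allVecs n (true ∷ false ∷ [])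

∈-allSubsets : ∀ {n} (B : Subset n) → B ∈ allSubsets n
∈-allSubsets B = ∈-allVecs _ B (λ i → bool∈ (lookup B i))
  where
  bool∈ : ∀ b → b ∈ true ∷ false ∷ []
  bool∈ true  = here refl
  bool∈ false = there (here refl)

length-allSubsets : ∀ n → length (allSubsets n) ≡ 2 ^ n
length-allSubsets n = length-allVecs n _

sum-allSubsets-product : ∀ n y z →
  sum (map (λ B → product (tabulate (λ i → if lookup B i then y else z))) (allSubsets n)) ≡ (y + z) ^ n
sum-allSubsets-product n y z =
  trans (sum-allVecs-product n (λ _ b → if b then y else z) _)
        (trans (product-tabulate-cong {n} (λ _ → cong (y +_) (+-identityʳ z)))
               (product-tabulate-const n (y + z)))

product-tabulate-if : ∀ {n} (B : Subset n) y z →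
  product (tabulate (λ i → if lookup B i then y else z)) * z ^ ∣ B ∣ ≡ y ^ ∣ B ∣ * z ^ n
product-tabulate-if []          y z = refl
product-tabulate-if (true ∷ B)  y z =
  trans (rearrange y _ z (z ^ ∣ B ∣)) (trans (cong (λ w → z * (y * w)) (product-tabulate-if B y z))
                                                 (sym (rearrange y (y ^ ∣ B ∣) z _)))
  where
  rearrange : ∀ a b c d → a * b * (c * d) ≡ c * (a * (b * d))
  rearrange = solve-∀
product-tabulate-if (false ∷ B) y z =
  trans (*-assoc z _ (z ^ ∣ B ∣)) (trans (cong (z *_) (product-tabulate-if B y z))
                                           (x∙yz≈y∙xz z (y ^ ∣ B ∣) _))

sum-tabulate-if : ∀ {n} (A : Subset n) d →
  sum (tabulate (λ i → if lookup A i then suc d else 1)) ≡ n + d * ∣ A ∣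
sum-tabulate-if []          d = sym (*-zeroʳ d)
sum-tabulate-if (true ∷ A)  d = cong suc (trans (cong (d +_) (sum-tabulate-if A d)) (shift d _ ∣ A ∣))
  where
  shift : ∀ d n a → d + (n + d * a) ≡ n + d * (1 + a)
  shift = solve-∀
sum-tabulate-if (false ∷ A) d = cong suc (sum-tabulate-if A d)

^-distribʳ-* : ∀ x y k → (x * y) ^ k ≡ x ^ k * y ^ k
^-distribʳ-* x y zero    = refl
^-distribʳ-* x y (suc k) = trans (cong (x * y *_) (^-distribʳ-* x y k)) (interchange x y (x ^ k) (y ^ k))

^-^-comm : ∀ x a b → (x ^ a) ^ b ≡ (x ^ b) ^ a
^-^-comm x a b = trans (^-*-assoc x a b) (trans (cong (x ^_) (*-comm a b)) (sym (^-*-assoc x b a)))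

^-cancelʳ-≤ : ∀ k .{{_ : NonZero k}} {x y} → x ^ k ≤ y ^ k → x ≤ y
^-cancelʳ-≤ k {x} {y} xᵏ≤yᵏ with x ≤? y
... | yes x≤y = x≤y
... | no  x≰y = contradiction xᵏ≤yᵏ (<⇒≱ (^-monoˡ-< k (≰⇒> x≰y)))

[1+q]^j*r≤q^[1+j] : ∀ q j r → j + r ≡ q → suc q ^ j * r ≤ q ^ suc j
[1+q]^j*r≤q^[1+j] q zero    r refl = ≤-reflexive (trans (*-identityˡ q) (sym (*-identityʳ q)))
[1+q]^j*r≤q^[1+j] q (suc j) r j+r≡q = begin
  suc q ^ suc j * r        ≡⟨ regroup (suc q ^ j) q r ⟩
  suc q ^ j * (suc q * r)  ≤⟨ *-monoʳ-≤ (suc q ^ j) [1+q]r≤[1+r]q ⟩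
  suc q ^ j * (suc r * q)  ≡⟨ sym (*-assoc (suc q ^ j) (suc r) q) ⟩
  suc q ^ j * suc r * q    ≤⟨ *-monoˡ-≤ q ([1+q]^j*r≤q^[1+j] q j (suc r) (trans (+-suc j r) j+r≡q)) ⟩
  q ^ suc j * q            ≡⟨ *-comm (q ^ suc j) q ⟩
  q ^ suc (suc j)          ∎
  where
  open ≤-Reasoning
  regroup : ∀ a q r → (1 + q) * a * r ≡ a * ((1 + q) * r)
  regroup = solve-∀
  [1+q]r≤[1+r]q : suc q * r ≤ suc r * q
  [1+q]r≤[1+r]q = +-mono-≤ (subst (r ≤_) j+r≡q (m≤n+m r (suc j))) (≤-reflexive (*-comm q r))

-- (1 + 1/q)^q ≤ (4/3)^4
CompoundBound : ℕ → Set
CompoundBound q = 81 * suc q ^ q ≤ 256 * q ^ q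

compoundBound-4* : ∀ s .{{_ : NonZero s}} → CompoundBound (4 * s)
compoundBound-4* s = begin
  81 * suc q ^ q            ≡⟨ cong (81 *_) (^q≡^s^4 (suc q)) ⟩
  81 * (suc q ^ s) ^ 4      ≡⟨ sym (^-distribʳ-* 3 (suc q ^ s) 4) ⟩
  (3 * suc q ^ s) ^ 4       ≤⟨ ^-monoˡ-≤ 4 3[1+q]^s≤4q^s ⟩
  (4 * q ^ s) ^ 4           ≡⟨ ^-distribʳ-* 4 (q ^ s) 4 ⟩
  256 * (q ^ s) ^ 4         ≡⟨ cong (256 *_) (sym (^q≡^s^4 q)) ⟩
  256 * q ^ q               ∎
  where
  open ≤-Reasoning
  q : ℕ
  q = 4 * s
  ^q≡^s^4 : ∀ x → x ^ q ≡ (x ^ s) ^ 4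
  ^q≡^s^4 x = trans (cong (x ^_) (*-comm 4 s)) (sym (^-*-assoc x s 4))
  3[1+q]^s≤4q^s : 3 * suc q ^ s ≤ 4 * q ^ s
  3[1+q]^s≤4q^s = *-cancelʳ-≤ _ _ s (begin
    3 * suc q ^ s * s    ≡⟨ regroup (suc q ^ s) s ⟩
    suc q ^ s * (3 * s)  ≤⟨ [1+q]^j*r≤q^[1+j] q s (3 * s) (s+3s≡4s s) ⟩
    q * q ^ s            ≡⟨ regroup′ s (q ^ s) ⟩
    4 * q ^ s * s        ∎)
    where
    regroup : ∀ a s → 3 * a * s ≡ a * (3 * s)
    regroup = solve-∀
    regroup′ : ∀ s b → 4 * s * b ≡ 4 * b * s
    regroup′ = solve-∀
    s+3s≡4s : ∀ s → s + 3 * s ≡ 4 * s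
    s+3s≡4s = solve-∀

compoundBound-2^ : ∀ m → CompoundBound (2 ^ m)
compoundBound-2^ zero          = ≤ᵇ⇒≤ 162 256 _
compoundBound-2^ (suc zero)    = ≤ᵇ⇒≤ 729 1024 _
compoundBound-2^ (suc (suc m)) = subst CompoundBound (4x≡2[2x] (2 ^ m)) (compoundBound-4* (2 ^ m) {{m^n≢0 2 m}})
  where
  4x≡2[2x] : ∀ x → 4 * x ≡ 2 * (2 * x)
  4x≡2[2x] = solve-∀

bernoulli : ∀ q p → (q + p) * q ^ p ≤ q * suc q ^ p
bernoulli q zero    = ≤-reflexive (cong (_* 1) (+-identityʳ q))
bernoulli q (suc p) = begin
  (q + suc p) * (q * q ^ p)   ≡⟨ regroup q p (q ^ p) ⟩
  (q + suc p) * q * q ^ p     ≤⟨ *-monoˡ-≤ (q ^ p) step ⟩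
  suc q * (q + p) * q ^ p     ≡⟨ *-assoc (suc q) (q + p) (q ^ p) ⟩
  suc q * ((q + p) * q ^ p)   ≤⟨ *-monoʳ-≤ (suc q) (bernoulli q p) ⟩
  suc q * (q * suc q ^ p)     ≡⟨ x∙yz≈y∙xz (suc q) q (suc q ^ p) ⟩
  q * (suc q * suc q ^ p)     ∎
  where
  open ≤-Reasoning
  regroup : ∀ q p x → (q + suc p) * (q * x) ≡ (q + suc p) * q * x
  regroup = solve-∀
  expand : ∀ q p → (q + suc p) * q + p ≡ suc q * (q + p)
  expand = solve-∀
  step : (q + suc p) * q ≤ suc q * (q + p)
  step = subst ((q + suc p) * q ≤_) (expand q p) (m≤m+n _ p)

-- (1 + p/q)^q ≤ (1 + 1/q)^(q p) ≤ (256/81)^p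
81^p*[q+p]^q≤256^p*q^q : ∀ q p .{{_ : NonZero q}} → CompoundBound q → 81 ^ p * (q + p) ^ q ≤ 256 ^ p * q ^ q
81^p*[q+p]^q≤256^p*q^q q p bound = *-cancelʳ-≤ _ _ (qᵠ ^ p) {{m^n≢0 qᵠ p {{m^n≢0 q q}}}} (begin
  81 ^ p * (q + p) ^ q * qᵠ ^ p          ≡⟨ cong (81 ^ p * (q + p) ^ q *_) (^-^-comm q q p) ⟩
  81 ^ p * (q + p) ^ q * (q ^ p) ^ q     ≡⟨ *-assoc (81 ^ p) _ _ ⟩
  81 ^ p * ((q + p) ^ q * (q ^ p) ^ q)   ≡⟨ cong (81 ^ p *_) (sym (^-distribʳ-* (q + p) (q ^ p) q)) ⟩
  81 ^ p * ((q + p) * q ^ p) ^ q         ≤⟨ *-monoʳ-≤ (81 ^ p) (^-monoˡ-≤ q (bernoulli q p)) ⟩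
  81 ^ p * (q * suc q ^ p) ^ q           ≡⟨ cong (81 ^ p *_) (^-distribʳ-* q (suc q ^ p) q) ⟩
  81 ^ p * (qᵠ * (suc q ^ p) ^ q)        ≡⟨ cong (λ x → 81 ^ p * (qᵠ * x)) (^-^-comm (suc q) p q) ⟩
  81 ^ p * (qᵠ * (suc q ^ q) ^ p)        ≡⟨ x∙yz≈y∙xz (81 ^ p) qᵠ _ ⟩
  qᵠ * (81 ^ p * (suc q ^ q) ^ p)        ≡⟨ cong (qᵠ *_) (sym (^-distribʳ-* 81 (suc q ^ q) p)) ⟩
  qᵠ * (81 * suc q ^ q) ^ p              ≤⟨ *-monoʳ-≤ qᵠ (^-monoˡ-≤ p bound) ⟩
  qᵠ * (256 * qᵠ) ^ p                    ≡⟨ cong (qᵠ *_) (^-distribʳ-* 256 qᵠ p) ⟩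
  qᵠ * (256 ^ p * qᵠ ^ p)                ≡⟨ x∙yz≈y∙xz qᵠ (256 ^ p) _ ⟩
  256 ^ p * (qᵠ * qᵠ ^ p)                ≡⟨ sym (*-assoc (256 ^ p) qᵠ _) ⟩
  256 ^ p * qᵠ * qᵠ ^ p                  ∎)
  where
  open ≤-Reasoning
  qᵠ : ℕ
  qᵠ = q ^ q

2^-^ : ∀ a k → (2 ^ a) ^ k ≡ 2 ^ (k * a)
2^-^ a k = trans (^-*-assoc 2 a k) (cong (2 ^_) (*-comm a k))

-- (256/81)^10 ≤ 2^18, so a factor (256/81)^e costs at most 1.8 e bits.
81^e-absorb : ∀ e {x y s r} → 81 ^ e * (x * 2 ^ s) ≤ 256 ^ e * y → 18 * e + 10 * r ≤ 10 * s → x * 2 ^ r ≤ y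
81^e-absorb e {x} {y} {s} {r} hyp slack = ^-cancelʳ-≤ 10 (*-cancelˡ-≤ (2 ^ (80 * e)) {{m^n≢0 2 (80 * e)}} (begin
  2 ^ (80 * e) * (x * 2 ^ r) ^ 10             ≡⟨ gather ⟩
  2 ^ (80 * e + 10 * r) * x ^ 10              ≤⟨ *-monoˡ-≤ (x ^ 10) (^-monoʳ-≤ 2 exponents) ⟩
  2 ^ (62 * e + 10 * s) * x ^ 10              ≡⟨ cong (_* x ^ 10) split ⟩
  (2 ^ 62) ^ e * (2 ^ s) ^ 10 * x ^ 10        ≤⟨ *-monoˡ-≤ (x ^ 10) (*-monoˡ-≤ ((2 ^ s) ^ 10) (^-monoˡ-≤ e 2^62≤81^10)) ⟩
  (81 ^ 10) ^ e * (2 ^ s) ^ 10 * x ^ 10       ≡⟨ collect ⟩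
  (81 ^ e * (x * 2 ^ s)) ^ 10                 ≤⟨ ^-monoˡ-≤ 10 hyp ⟩
  (256 ^ e * y) ^ 10                          ≡⟨ trans (^-distribʳ-* (256 ^ e) y 10) (cong (_* y ^ 10) 256^e^10) ⟩
  2 ^ (80 * e) * y ^ 10                       ∎))
  where
  open ≤-Reasoning
  exponents : 80 * e + 10 * r ≤ 62 * e + 10 * s
  exponents = subst (_≤ 62 * e + 10 * s) (regroup e r) (+-monoʳ-≤ (62 * e) slack)
    where
    regroup : ∀ e r → 62 * e + (18 * e + 10 * r) ≡ 80 * e + 10 * r
    regroup = solve-∀
  2^62≤81^10 : 2 ^ 62 ≤ 81 ^ 10
  2^62≤81^10 = ≤ᵇ⇒≤ (2 ^ 62) (81 ^ 10) _
  gather : 2 ^ (80 * e) * (x * 2 ^ r) ^ 10 ≡ 2 ^ (80 * e + 10 * r) * x ^ 10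
  gather = begin-equality
    2 ^ (80 * e) * (x * 2 ^ r) ^ 10         ≡⟨ cong (2 ^ (80 * e) *_) (^-distribʳ-* x (2 ^ r) 10) ⟩
    2 ^ (80 * e) * (x ^ 10 * (2 ^ r) ^ 10)  ≡⟨ x∙yz≈xz∙y (2 ^ (80 * e)) (x ^ 10) _ ⟩
    2 ^ (80 * e) * (2 ^ r) ^ 10 * x ^ 10    ≡⟨ cong (λ y → 2 ^ (80 * e) * y * x ^ 10) (2^-^ r 10) ⟩
    2 ^ (80 * e) * 2 ^ (10 * r) * x ^ 10    ≡⟨ cong (_* x ^ 10) (sym (^-distribˡ-+-* 2 (80 * e) (10 * r))) ⟩
    2 ^ (80 * e + 10 * r) * x ^ 10          ∎
  split : 2 ^ (62 * e + 10 * s) ≡ (2 ^ 62) ^ e * (2 ^ s) ^ 10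
  split = trans (^-distribˡ-+-* 2 (62 * e) (10 * s)) (cong₂ _*_ (sym (^-*-assoc 2 62 e)) (sym (2^-^ s 10)))
  collect : (81 ^ 10) ^ e * (2 ^ s) ^ 10 * x ^ 10 ≡ (81 ^ e * (x * 2 ^ s)) ^ 10
  collect = begin-equality
    (81 ^ 10) ^ e * (2 ^ s) ^ 10 * x ^ 10    ≡⟨ *-assoc ((81 ^ 10) ^ e) _ _ ⟩
    (81 ^ 10) ^ e * ((2 ^ s) ^ 10 * x ^ 10)  ≡⟨ cong₂ _*_ (^-^-comm 81 10 e) (*-comm _ (x ^ 10)) ⟩
    (81 ^ e) ^ 10 * (x ^ 10 * (2 ^ s) ^ 10)  ≡⟨ cong ((81 ^ e) ^ 10 *_) (sym (^-distribʳ-* x (2 ^ s) 10)) ⟩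
    (81 ^ e) ^ 10 * (x * 2 ^ s) ^ 10         ≡⟨ sym (^-distribʳ-* (81 ^ e) _ 10) ⟩
    (81 ^ e * (x * 2 ^ s)) ^ 10              ∎
  256^e^10 : (256 ^ e) ^ 10 ≡ 2 ^ (80 * e)
  256^e^10 = trans (cong (_^ 10) (2^-^ 8 e)) (trans (2^-^ (e * 8) 10) (cong (2 ^_) (regroup e)))
    where
    regroup : ∀ e → 10 * (e * 8) ≡ 80 * e
    regroup = solve-∀

x^M*2^[δW]≤S^M : ∀ M {x S δ t W} → x * (2 ^ δ) ^ t ≤ S → W ≤ M * t → x ^ M * 2 ^ (δ * W) ≤ S ^ M
x^M*2^[δW]≤S^M M {x} {S} {δ} {t} {W} markov W≤Mt = begin
  x ^ M * 2 ^ (δ * W)          ≤⟨ *-monoʳ-≤ (x ^ M) (^-monoʳ-≤ 2 (*-monoʳ-≤ δ W≤Mt)) ⟩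
  x ^ M * 2 ^ (δ * (M * t))    ≡⟨ cong (x ^ M *_) 2^δMt≡[[2^δ]^t]^M ⟩
  x ^ M * ((2 ^ δ) ^ t) ^ M    ≡⟨ sym (^-distribʳ-* x _ M) ⟩
  (x * (2 ^ δ) ^ t) ^ M        ≤⟨ ^-monoˡ-≤ M markov ⟩
  S ^ M                           ∎
  where
  open ≤-Reasoning
  regroup : ∀ δ M t → δ * (M * t) ≡ δ * t * M
  regroup = solve-∀
  2^δMt≡[[2^δ]^t]^M : 2 ^ (δ * (M * t)) ≡ ((2 ^ δ) ^ t) ^ M
  2^δMt≡[[2^δ]^t]^M = sym (trans (cong (_^ M) (^-*-assoc 2 δ t))
                                 (trans (^-*-assoc 2 (δ * t) M) (cong (2 ^_) (sym (regroup δ M t)))))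

81^e*S^M≤256^e*T^M : ∀ M .{{_ : NonZero M}} {S T p L} → CompoundBound M →
  S * M ^ L ≡ (M + p) ^ L * T → 81 ^ (p * L) * S ^ M ≤ 256 ^ (p * L) * T ^ M
81^e*S^M≤256^e*T^M M {S} {T} {p} {L} bound moment = *-cancelʳ-≤ _ _ (Mᴹ ^ L) {{m^n≢0 Mᴹ L {{m^n≢0 M M}}}} (begin
  81 ^ (p * L) * S ^ M * Mᴹ ^ L                ≡⟨ cong (81 ^ (p * L) * S ^ M *_) (^-^-comm M M L) ⟩
  81 ^ (p * L) * S ^ M * (M ^ L) ^ M           ≡⟨ *-assoc (81 ^ (p * L)) _ _ ⟩
  81 ^ (p * L) * (S ^ M * (M ^ L) ^ M)         ≡⟨ cong (81 ^ (p * L) *_) (sym (^-distribʳ-* S (M ^ L) M)) ⟩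
  81 ^ (p * L) * (S * M ^ L) ^ M               ≡⟨ cong (λ z → 81 ^ (p * L) * z ^ M) moment ⟩
  81 ^ (p * L) * ((M + p) ^ L * T) ^ M         ≡⟨ cong (81 ^ (p * L) *_) (^-distribʳ-* _ T M) ⟩
  81 ^ (p * L) * (((M + p) ^ L) ^ M * T ^ M)   ≡⟨ sym (*-assoc (81 ^ (p * L)) _ _) ⟩
  81 ^ (p * L) * ((M + p) ^ L) ^ M * T ^ M     ≡⟨ cong (_* T ^ M) (^L-collect 81 (M + p)) ⟩
  (81 ^ p * (M + p) ^ M) ^ L * T ^ M           ≤⟨ *-monoˡ-≤ (T ^ M) (^-monoˡ-≤ L (81^p*[q+p]^q≤256^p*q^q M p bound)) ⟩
  (256 ^ p * Mᴹ) ^ L * T ^ M                   ≡⟨ cong (_* T ^ M) (sym (^L-collect 256 M)) ⟩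
  256 ^ (p * L) * (M ^ L) ^ M * T ^ M          ≡⟨ cong (λ z → 256 ^ (p * L) * z * T ^ M) (^-^-comm M L M) ⟩
  256 ^ (p * L) * Mᴹ ^ L * T ^ M               ≡⟨ xy∙z≈xz∙y (256 ^ (p * L)) _ _ ⟩
  256 ^ (p * L) * T ^ M * Mᴹ ^ L               ∎)
  where
  open ≤-Reasoning
  Mᴹ : ℕ
  Mᴹ = M ^ M
  ^L-collect : ∀ c x → c ^ (p * L) * (x ^ L) ^ M ≡ (c ^ p * x ^ M) ^ L
  ^L-collect c x = trans (cong₂ _*_ (sym (^-*-assoc c p L)) (^-^-comm x L M)) (sym (^-distribʳ-* (c ^ p) (x ^ M) L))

2*d≤δ*2^δ : ∀ δ {d} → 2 ^ δ ≡ suc d → 2 * d ≤ δ * 2 ^ δ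
2*d≤δ*2^δ zero          refl = z≤n
2*d≤δ*2^δ (suc zero)    refl = ≤-refl
2*d≤δ*2^δ (suc (suc δ)) {d} 2^δ≡1+d = begin
  2 * d              ≤⟨ *-monoʳ-≤ 2 (n≤1+n d) ⟩
  2 * suc d          ≡⟨ cong (2 *_) (sym 2^δ≡1+d) ⟩
  2 * 2 ^ suc (suc δ)  ≤⟨ *-monoˡ-≤ (2 ^ suc (suc δ)) (s≤s (s≤s (z≤n {δ}))) ⟩
  suc (suc δ) * 2 ^ suc (suc δ) ∎
  where open ≤-Reasoning

exponent-slack : ∀ {δ Δ d C a b L M g} .{{_ : NonZero C}} → 2 * d ≤ δ * Δ →
  M ≤ C * Δ * a → 10 * C * g ≤ δ * b * L →
  18 * (d * a * (L * b)) + 10 * (g * M) ≤ 10 * (δ * (Δ * a * b * L))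
exponent-slack {δ} {Δ} {d} {C} {a} {b} {L} {M} {g} 2d≤δΔ M≤CΔa Cg≤δbL = begin
  18 * (d * a * (L * b)) + 10 * (g * M)     ≡⟨ cong (_+ 10 * (g * M)) (regroup d a L b) ⟩
  9 * (2 * d) * (a * b * L) + 10 * (g * M)  ≤⟨ +-mono-≤ (*-monoˡ-≤ (a * b * L) (*-monoʳ-≤ 9 2d≤δΔ)) gM≤δW ⟩
  9 * (δ * Δ) * (a * b * L) + δ * W         ≡⟨ sum-up δ Δ a b L ⟩
  10 * (δ * W)                              ∎
  where
  open ≤-Reasoning
  W : ℕ
  W = Δ * a * b * L
  regroup : ∀ d a L b → 18 * (d * a * (L * b)) ≡ 9 * (2 * d) * (a * b * L)
  regroup = solve-∀
  sum-up : ∀ δ Δ a b L → 9 * (δ * Δ) * (a * b * L) + δ * (Δ * a * b * L) ≡ 10 * (δ * (Δ * a * b * L))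
  sum-up = solve-∀
  gM≤δW : 10 * (g * M) ≤ δ * W
  gM≤δW = *-cancelˡ-≤ C (begin
    C * (10 * (g * M))      ≡⟨ regroup′ C g M ⟩
    10 * C * g * M          ≤⟨ *-monoˡ-≤ M Cg≤δbL ⟩
    δ * b * L * M           ≤⟨ *-monoʳ-≤ (δ * b * L) M≤CΔa ⟩
    δ * b * L * (C * Δ * a) ≡⟨ regroup″ δ b L C Δ a ⟩
    C * (δ * W)             ∎)
    where
    regroup′ : ∀ C g M → C * (10 * (g * M)) ≡ 10 * C * g * M
    regroup′ = solve-∀
    regroup″ : ∀ δ b L C Δ a → δ * b * L * (C * Δ * a) ≡ C * (δ * (Δ * a * b * L))
    regroup″ = solve-∀

-- Markov's inequality for Δ^count: if S sums Δ^count over T tables and x of them have count ≥ t,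
-- then x Δ^t ≤ S = T (1 + d a/M)^(L b), and the remaining hypotheses make this at most T / 2^g.
tail-bound : ∀ M .{{_ : NonZero M}} → CompoundBound M →
  ∀ {δ d C a b L g x S T t} .{{_ : NonZero C}} →
  2 * d ≤ δ * 2 ^ δ → M ≤ C * 2 ^ δ * a → 10 * C * g ≤ δ * b * L →
  S * M ^ (L * b) ≡ (M + d * a) ^ (L * b) * T →
  x * (2 ^ δ) ^ t ≤ S → 2 ^ δ * a * b * L ≤ M * t →
  x * 2 ^ g ≤ T
tail-bound M bound {δ} {d} {C} {a} {b} {L} {g} {x} {S} {T} {t} 2d≤δΔ M≤CΔa Cg≤δbL moment markov W≤Mt =
  ^-cancelʳ-≤ M (subst (_≤ T ^ M) x^M*2^gM≡[x*2^g]^M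
    (81^e-absorb e {x ^ M} {T ^ M} {δ * W} {g * M} tilted
       (exponent-slack {δ} {2 ^ δ} {d} {C} {a} {b} {L} {M} {g} 2d≤δΔ M≤CΔa Cg≤δbL)))
  where
  W e : ℕ
  W = 2 ^ δ * a * b * L
  e = d * a * (L * b)
  x^M*2^gM≡[x*2^g]^M : x ^ M * 2 ^ (g * M) ≡ (x * 2 ^ g) ^ M
  x^M*2^gM≡[x*2^g]^M = sym (trans (^-distribʳ-* x (2 ^ g) M) (cong (x ^ M *_) (^-*-assoc 2 g M)))
  tilted : 81 ^ e * (x ^ M * 2 ^ (δ * W)) ≤ 256 ^ e * T ^ M
  tilted = ≤-trans (*-monoʳ-≤ (81 ^ e) (x^M*2^[δW]≤S^M M {x} {S} {δ} {t} {W} markov W≤Mt))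
                   (81^e*S^M≤256^e*T^M M {S} {T} {d * a} {L * b} bound moment)

-- Each of the three summands 10C·M, 10C·2 and 10C·(n+1)b is at most a third of δbL.
exponent-budget : ∀ {C n K b δ L M} → 1 ≤ n → 1 ≤ K → K ≤ b →
  60 * C * n ≤ δ * L → 30 * C * M ≤ δ * K * L → 10 * C * (M + 2 + suc n * b) ≤ δ * b * L
exponent-budget {C} {n} {K} {b} {δ} {L} {M} 1≤n 1≤K K≤b n≪δL M≪δKL = *-cancelˡ-≤ 3 (begin
  3 * (10 * C * (M + 2 + suc n * b))                       ≡⟨ split C M n b ⟩
  30 * C * M + (60 * C * 1 + 30 * C * (suc n * b))        ≤⟨ +-mono-≤ M-part (+-mono-≤ 2-part n-part) ⟩
  δ * b * L + (60 * C * n * b + 60 * C * n * b)           ≤⟨ +-monoʳ-≤ (δ * b * L) (+-mono-≤ Cnb≤δbL Cnb≤δbL) ⟩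
  δ * b * L + (δ * b * L + δ * b * L)                     ≡⟨ triple (δ * b * L) ⟩
  3 * (δ * b * L)                                          ∎)
  where
  open ≤-Reasoning
  split : ∀ C M n b → 3 * (10 * C * (M + 2 + (1 + n) * b)) ≡ 30 * C * M + (60 * C * 1 + 30 * C * ((1 + n) * b))
  split = solve-∀
  triple : ∀ x → x + (x + x) ≡ 3 * x
  triple = solve-∀
  1≤b : 1 ≤ b
  1≤b = ≤-trans 1≤K K≤b
  M-part : 30 * C * M ≤ δ * b * L
  M-part = ≤-trans M≪δKL (*-monoˡ-≤ L (*-monoʳ-≤ δ K≤b))
  2-part : 60 * C * 1 ≤ 60 * C * n * b
  2-part = ≤-trans (*-monoʳ-≤ (60 * C) 1≤n)
                   (subst (_≤ 60 * C * n * b) (*-identityʳ _) (*-monoʳ-≤ (60 * C * n) 1≤b))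
  n-part : 30 * C * (suc n * b) ≤ 60 * C * n * b
  n-part = subst (30 * C * (suc n * b) ≤_) (double C n b) (*-monoʳ-≤ (30 * C) (*-monoˡ-≤ b (+-monoˡ-≤ n 1≤n)))
    where
    double : ∀ C n b → 30 * C * ((n + n) * b) ≡ 60 * C * n * b
    double = solve-∀
  Cnb≤δbL : 60 * C * n * b ≤ δ * b * L
  Cnb≤δbL = subst (60 * C * n * b ≤_) (xy∙z≈xz∙y δ L b) (*-monoˡ-≤ b n≪δL)

indicator : {P : Set} → Dec P → ℕ
indicator (yes _) = 1
indicator (no _)  = 0

indicator-mono : {P Q : Set} → (P → Q) → (p : Dec P) (q : Dec Q) → indicator p ≤ indicator q
indicator-mono P→Q (yes p) (yes _) = ≤-refl
indicator-mono P→Q (yes p) (no ¬q) = contradiction (P→Q p) ¬q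
indicator-mono P→Q (no _)  _       = z≤n

¬⇒indicator≡0 : {P : Set} → ¬ P → (p : Dec P) → indicator p ≡ 0
¬⇒indicator≡0 ¬P (yes p) = contradiction p ¬P
¬⇒indicator≡0 ¬P (no _)  = refl

indicator≡0⇒¬ : {P : Set} (p : Dec P) → indicator p ≡ 0 → ¬ P
indicator≡0⇒¬ (no ¬p) _ = ¬p

m<n*o⇒m/n<o : ∀ {m} n .{{_ : NonZero n}} {o} → m < n * o → m / n < o
m<n*o⇒m/n<o {m} n {o} m<no = m<n*o⇒m/o<n (subst (m <_) (*-comm n o) m<no)

m≤n*[1+m/n] : ∀ m n .{{_ : NonZero n}} → m ≤ n * suc (m / n)
m≤n*[1+m/n] m n = begin
  m                   ≡⟨ m≡m%n+[m/n]*n m n ⟩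
  m % n + m / n * n   ≤⟨ +-monoˡ-≤ (m / n * n) (<⇒≤ (m%n<n m n)) ⟩
  n + m / n * n       ≡⟨ cong (n +_) (*-comm (m / n) n) ⟩
  n + n * (m / n)     ≡⟨ sym (*-suc n (m / n)) ⟩
  n * suc (m / n)     ∎
  where open ≤-Reasoning

-- Tables as vectors of rows, so that they can be enumerated; the sums over all tables are
-- exponential moments Σ Δ^(number of A-cells in B × [L]).
module Grids (N L M Δ : ℕ) where

  Grid : Set
  Grid = Vec (Vec (Fin M) L) N

  rows : List (Vec (Fin M) L)
  rows = allVecs L (allFin M)

  grids : List Grid
  grids = allVecs N rows

  table : Grid → Table N L M
  table T u v = lookup (lookup T u) v

  length-rows : length rows ≡ M ^ L
  length-rows = trans (length-allVecs L (allFin M)) (cong (_^ L) (length-tabulate (λ i → i)))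

  length-grids : length grids ≡ (M ^ L) ^ N
  length-grids = trans (length-allVecs N rows) (cong (_^ N) length-rows)

  cellWeight : Subset M → Fin M → ℕ
  cellWeight A c = if lookup A c then Δ else 1

  rowWeight : Bool → Subset M → Vec (Fin M) L → ℕ
  rowWeight b A r = if b then product (tabulate (λ v → cellWeight A (lookup r v))) else 1

  ^-countCells : ∀ T B A → Δ ^ countCells (table T) B A ≡ product (tabulate (λ u → rowWeight (lookup B u) A (lookup T u)))
  ^-countCells T B A =
    trans (cong (Δ ^_) (sum-allFin outer)) (trans (^-sum-tabulate Δ outer) (product-tabulate-cong {N} row))
    where
    inner : Fin N → Fin L → ℕ
    inner u v = if lookup A (table T u v) then 1 else 0
    outer : Fin N → ℕ
    outer u = if lookup B u then sum (map (inner u) (allFin L)) else 0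
    cell : ∀ b → Δ ^ (if b then 1 else 0) ≡ (if b then Δ else 1)
    cell true  = *-identityʳ Δ
    cell false = refl
    row : ∀ u → Δ ^ outer u ≡ rowWeight (lookup B u) A (lookup T u)
    row u with lookup B u
    ... | true  = trans (cong (Δ ^_) (sum-allFin (inner u)))
                        (trans (^-sum-tabulate Δ (inner u))
                               (product-tabulate-cong {L} (λ v → cell (lookup A (table T u v)))))
    ... | false = refl

  sum-rowWeight : ∀ b A → sum (map (rowWeight b A) rows) ≡ (if b then sum (tabulate (cellWeight A)) ^ L else M ^ L)
  sum-rowWeight true  A = trans (sum-allVecs-product L (λ _ → cellWeight A) (allFin M))
                                (trans (product-tabulate-const L _) (cong (_^ L) (sum-allFin (cellWeight A))))
  sum-rowWeight false A = trans (sum-map-1 rows) length-rows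

  moment : Subset N → Subset M → ℕ
  moment B A = sum (map (λ T → Δ ^ countCells (table T) B A) grids)

  moment-factorises : ∀ B A →
    moment B A * (M ^ L) ^ ∣ B ∣ ≡ (sum (tabulate (cellWeight A)) ^ L) ^ ∣ B ∣ * length grids
  moment-factorises B A = begin
    moment B A * (M ^ L) ^ ∣ B ∣
      ≡⟨ cong (_* (M ^ L) ^ ∣ B ∣) (trans (sum-map-cong grids (λ T → ^-countCells T B A))
                                          (sum-allVecs-product N (λ u → rowWeight (lookup B u) A) rows)) ⟩
    product (tabulate (λ u → sum (map (rowWeight (lookup B u) A) rows))) * (M ^ L) ^ ∣ B ∣
      ≡⟨ cong (_* (M ^ L) ^ ∣ B ∣) (product-tabulate-cong (λ u → sum-rowWeight (lookup B u) A)) ⟩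
    product (tabulate (λ u → if lookup B u then X ^ L else M ^ L)) * (M ^ L) ^ ∣ B ∣
      ≡⟨ product-tabulate-if B (X ^ L) (M ^ L) ⟩
    (X ^ L) ^ ∣ B ∣ * (M ^ L) ^ N
      ≡⟨ cong ((X ^ L) ^ ∣ B ∣ *_) (sym length-grids) ⟩
    (X ^ L) ^ ∣ B ∣ * length grids ∎
    where
    open ≡-Reasoning
    X : ℕ
    X = sum (tabulate (cellWeight A))

  moment-identity : ∀ {d} → Δ ≡ suc d → ∀ B A →
    moment B A * M ^ (L * ∣ B ∣) ≡ (M + d * ∣ A ∣) ^ (L * ∣ B ∣) * length grids
  moment-identity {d} Δ≡1+d B A =
    subst₂ (λ y z → moment B A * y ≡ z ^ (L * ∣ B ∣) * length grids) (^-*-assoc M L ∣ B ∣) X≡M+da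
      (trans (moment-factorises B A) (cong (_* length grids) (^-*-assoc _ L ∣ B ∣)))
    where
    X≡M+da : sum (tabulate (cellWeight A)) ≡ M + d * ∣ A ∣
    X≡M+da = subst (λ Δ′ → sum (tabulate (λ c → if lookup A c then Δ′ else 1)) ≡ M + d * ∣ A ∣)
                   (sym Δ≡1+d) (sum-tabulate-if A d)

  tailCount : ℕ → Subset N → Subset M → ℕ
  tailCount Y B A = sum (map (λ T → indicator (Y <? M * countCells (table T) B A)) grids)

  markov : .{{_ : NonZero M}} .{{_ : NonZero Δ}} → ∀ Y B A → tailCount Y B A * Δ ^ suc (Y / M) ≤ moment B A
  markov Y B A = subst (_≤ moment B A) (sum-map-*ʳ (Δ ^ suc (Y / M)) _ grids) (sum-map-mono grids exceeds)
    where
    exceeds : ∀ T → indicator (Y <? M * countCells (table T) B A) * Δ ^ suc (Y / M) ≤ Δ ^ countCells (table T) B A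
    exceeds T with Y <? M * countCells (table T) B A
    ... | yes Y<Mc = subst (_≤ Δ ^ countCells (table T) B A) (sym (*-identityˡ _)) (^-monoʳ-≤ Δ (m<n*o⇒m/n<o M Y<Mc))
    ... | no  _    = z≤n

suc[2n]^n≤2*[2n]^n : ∀ n → suc (2 * n) ^ n ≤ 2 * (2 * n) ^ n
suc[2n]^n≤2*[2n]^n zero        = s≤s z≤n
suc[2n]^n≤2*[2n]^n n@(suc _)   = *-cancelʳ-≤ _ _ n (begin
  suc (2 * n) ^ n * n      ≤⟨ [1+q]^j*r≤q^[1+j] (2 * n) n n (n+n≡2n n) ⟩
  2 * n * (2 * n) ^ n      ≡⟨ xy∙z≈xz∙y 2 n _ ⟩
  2 * (2 * n) ^ n * n      ∎)
  where
  open ≤-Reasoning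
  n+n≡2n : ∀ n → n + n ≡ 2 * n
  n+n≡2n = solve-∀

-- Weighting each B by (2N)^(N - |B|) turns Σ_B (2N)^-|B| into (1 + 1/(2N))^N ≤ 2.
union-bound : ∀ N .{{_ : NonZero N}} M (f : Subset N → Subset M → ℕ) T →
  (∀ B A → f B A * (2 ^ (M + 2) * (2 * N) ^ ∣ B ∣) ≤ T) →
  sum (map (λ B → sum (map (f B) (allSubsets M))) (allSubsets N)) * 2 ≤ T
union-bound N M f T bound = *-cancelʳ-≤ _ _ R {{R≢0}} (*-cancelˡ-≤ 2 (begin
  2 * (total * 2 * R)                          ≡⟨ regroup total (2 ^ M) ((2 * N) ^ N) ⟩
  total * (2 ^ M * 4 * (2 * N) ^ N)            ≡⟨ cong (λ c → total * (c * (2 * N) ^ N)) (sym (^-distribˡ-+-* 2 M 2)) ⟩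
  total * P                                    ≡⟨ sym (sum-map-*ʳ P row-total (allSubsets N)) ⟩
  sum (map (λ B → row-total B * P) (allSubsets N))
                                               ≤⟨ sum-map-mono (allSubsets N) per-B ⟩
  sum (map (λ B → 2 ^ M * T * w B) (allSubsets N))
                                               ≡⟨ sum-map-*ˡ (2 ^ M * T) w (allSubsets N) ⟩
  2 ^ M * T * sum (map w (allSubsets N))       ≡⟨ cong (2 ^ M * T *_) (sum-allSubsets-product N 1 (2 * N)) ⟩
  2 ^ M * T * suc (2 * N) ^ N                  ≤⟨ *-monoʳ-≤ (2 ^ M * T) (suc[2n]^n≤2*[2n]^n N) ⟩
  2 ^ M * T * (2 * (2 * N) ^ N)                ≡⟨ regroup′ (2 ^ M) T ((2 * N) ^ N) ⟩
  2 * (T * R)                                  ∎))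
  where
  open ≤-Reasoning
  row-total : Subset N → ℕ
  row-total B = sum (map (f B) (allSubsets M))
  total : ℕ
  total = sum (map row-total (allSubsets N))
  P R : ℕ
  P = 2 ^ (M + 2) * (2 * N) ^ N
  R = 2 ^ M * (2 * N) ^ N
  R≢0 : NonZero R
  R≢0 = m*n≢0 (2 ^ M) _ {{m^n≢0 2 M}} {{m^n≢0 (2 * N) N {{m*n≢0 2 N}}}}
  w : Subset N → ℕ
  w B = product (tabulate (λ i → if lookup B i then 1 else 2 * N))
  regroup : ∀ t x y → 2 * (t * 2 * (x * y)) ≡ t * (x * 4 * y)
  regroup = solve-∀
  regroup′ : ∀ x t y → x * t * (2 * y) ≡ 2 * (t * (x * y))
  regroup′ = solve-∀
  per-B : ∀ B → row-total B * P ≤ 2 ^ M * T * w B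
  per-B B = begin
    row-total B * P                                ≡⟨ sym (sum-map-*ʳ P (f B) (allSubsets M)) ⟩
    sum (map (λ A → f B A * P) (allSubsets M))     ≤⟨ sum-map-mono (allSubsets M) per-A ⟩
    sum (map (λ A → T * w B) (allSubsets M))       ≡⟨ sum-map-const (T * w B) (allSubsets M) ⟩
    T * w B * length (allSubsets M)                ≡⟨ cong (T * w B *_) (length-allSubsets M) ⟩
    T * w B * 2 ^ M                                ≡⟨ rotate T (w B) (2 ^ M) ⟩
    2 ^ M * T * w B                                ∎
    where
    rotate : ∀ t w x → t * w * x ≡ x * t * w
    rotate = solve-∀
    [2N]^N≡w*[2N]^∣B∣ : (2 * N) ^ N ≡ w B * (2 * N) ^ ∣ B ∣
    [2N]^N≡w*[2N]^∣B∣ = sym (trans (product-tabulate-if B 1 (2 * N))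
                                   (trans (cong (_* (2 * N) ^ N) (^-zeroˡ ∣ B ∣)) (*-identityˡ _)))
    per-A : ∀ A → f B A * P ≤ T * w B
    per-A A = begin
      f B A * (2 ^ (M + 2) * (2 * N) ^ N)              ≡⟨ cong (λ x → f B A * (2 ^ (M + 2) * x)) [2N]^N≡w*[2N]^∣B∣ ⟩
      f B A * (2 ^ (M + 2) * (w B * (2 * N) ^ ∣ B ∣))  ≡⟨ pull-out (f B A) (2 ^ (M + 2)) (w B) _ ⟩
      f B A * (2 ^ (M + 2) * (2 * N) ^ ∣ B ∣) * w B    ≤⟨ *-monoˡ-≤ (w B) (bound B A) ⟩
      T * w B                                          ∎
      where
      pull-out : ∀ a c x y → a * (c * (x * y)) ≡ a * (c * y) * x
      pull-out = solve-∀

m*2≤n⇒m<n : ∀ {m n} → 0 < n → m * 2 ≤ n → m < n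
m*2≤n⇒m<n {zero}  0<n _     = 0<n
m*2≤n⇒m<n {suc m} _   2m≤n = ≤-trans (+-monoʳ-≤ 2 (m≤m*n m 2)) 2m≤n

module Construction (n L m k D δ C : ℕ) .{{_ : NonZero C}} (1≤n : 1 ≤ n) (D≤CΔ : D ≤ C * 2 ^ δ)
                    (n≪δL : 60 * C * n ≤ δ * L) (M≪δKL : 30 * C * 2 ^ m ≤ δ * 2 ^ k * L) where

  N M K Δ : ℕ
  N = 2 ^ n
  M = 2 ^ m
  K = 2 ^ k
  Δ = 2 ^ δ

  instance
    N≢0 : NonZero N
    N≢0 = m^n≢0 2 n
    M≢0 : NonZero M
    M≢0 = m^n≢0 2 m
    Δ≢0 : NonZero Δ
    Δ≢0 = m^n≢0 2 δ

  open Grids N L M Δ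

  threshold : Subset N → Subset M → ℕ
  threshold B A = Δ * ∣ A ∣ * ∣ B ∣ * L

  Admissible : Subset N → Subset M → Set
  Admissible B A = K ≤ ∣ B ∣ × M ≤ D * ∣ A ∣

  Violates : Grid → Subset N → Subset M → Set
  Violates T B A = Admissible B A × threshold B A < M * countCells (table T) B A

  violates? : ∀ T B A → Dec (Violates T B A)
  violates? T B A = (K ≤? ∣ B ∣ ×-dec M ≤? D * ∣ A ∣) ×-dec threshold B A <? M * countCells (table T) B A

  violation : Grid → Subset N → Subset M → ℕ
  violation T B A = indicator (violates? T B A)

  badCount : Subset N → Subset M → ℕ
  badCount B A = sum (map (λ T → violation T B A) grids)

  badCount-bound : ∀ B A → badCount B A * (2 ^ (M + 2) * (2 * N) ^ ∣ B ∣) ≤ length grids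
  badCount-bound B A = by-admissibility (K ≤? ∣ B ∣ ×-dec M ≤? D * ∣ A ∣)
    where
    b a d g : ℕ
    b = ∣ B ∣
    a = ∣ A ∣
    d = pred Δ
    g = M + 2 + suc n * b
    2^g-split : 2 ^ g ≡ 2 ^ (M + 2) * (2 * N) ^ b
    2^g-split = trans (^-distribˡ-+-* 2 (M + 2) (suc n * b)) (cong (2 ^ (M + 2) *_) (sym (^-*-assoc 2 (suc n) b)))
    tail : Admissible B A → tailCount (threshold B A) B A * 2 ^ g ≤ length grids
    tail (K≤b , M≤Da) =
      tail-bound M (compoundBound-2^ m) {δ = δ} {d = d} {C = C} {a = a} {b = b} {L = L} {g = g}
        {x = tailCount (threshold B A) B A}
        (2*d≤δ*2^δ δ (sym (suc-pred Δ))) (≤-trans M≤Da (*-monoˡ-≤ a D≤CΔ))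
        (exponent-budget {C = C} {δ = δ} {L = L} {M = M} 1≤n (m^n>0 2 k) K≤b n≪δL M≪δKL)
        (moment-identity (sym (suc-pred Δ)) B A) (markov (threshold B A) B A) (m≤n*[1+m/n] (threshold B A) M)
    by-admissibility : Dec (Admissible B A) → badCount B A * (2 ^ (M + 2) * (2 * N) ^ ∣ B ∣) ≤ length grids
    by-admissibility (no ¬admissible) =
      subst (λ c → c * _ ≤ length grids)
            (sym (trans (sum-map-cong grids (λ T → ¬⇒indicator≡0 (¬admissible ∘ proj₁) (violates? T B A)))
                        (sum-map-const 0 grids)))
            z≤n
    by-admissibility (yes admissible) =
      ≤-trans (*-monoˡ-≤ _ (sum-map-mono grids (λ T → indicator-mono proj₂ (violates? T B A) _)))
              (subst (λ c → tailCount (threshold B A) B A * c ≤ length grids) 2^g-split (tail admissible))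

  defects : Grid → ℕ
  defects T = sum (map (λ B → sum (map (violation T B) (allSubsets M))) (allSubsets N))

  few-defects : sum (map defects grids) < length grids
  few-defects = m*2≤n⇒m<n (subst (0 <_) (sym length-grids) (m^n>0 (M ^ L) {{m^n≢0 M L}} N))
                  (subst (λ s → s * 2 ≤ length grids) (sym swap) (union-bound N M badCount _ badCount-bound))
    where
    swap : sum (map defects grids) ≡ sum (map (λ B → sum (map (badCount B) (allSubsets M))) (allSubsets N))
    swap = trans (sum-map-swap (λ T B → sum (map (violation T B) (allSubsets M))) grids (allSubsets N))
                 (sum-map-cong (allSubsets N) (λ B → sum-map-swap (λ T → violation T B) grids (allSubsets M)))

  defect-free⇒balanced : ∀ T → defects T ≡ 0 → Balanced K D Δ (table T)
  defect-free⇒balanced T none B A K≤b M≤Da = ≮⇒≥ λ exceeds →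
    indicator≡0⇒¬ (violates? T B A) (sum-map≡0⇒zero _ (sum-map≡0⇒zero _ none (∈-allSubsets B)) (∈-allSubsets A))
      ((K≤b , M≤Da) , exceeds)

  balanced-table : Σ (Table N L M) (Balanced K D Δ)
  balanced-table = table T , defect-free⇒balanced T none
    where
    defect-free : ∃ λ T → defects T ≡ 0
    defect-free = sum-map<length⇒zero defects grids few-defects
    T : Grid
    T = proj₁ defect-free
    none : defects T ≡ 0
    none = proj₂ defect-free

eventually-× : ∀ {P Q : ℕ → Set} → Eventually P → Eventually Q → Eventually (λ n → P n × Q n)
eventually-× (a , p) (b , q) = a ⊔ b , λ n a⊔b≤n → p n (m⊔n≤o⇒m≤o a b a⊔b≤n) , q n (m⊔n≤o⇒n≤o a b a⊔b≤n)

eventually-map : ∀ {P Q : ℕ → Set} → (∀ n → P n → Q n) → Eventually P → Eventually Q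
eventually-map f (a , p) = a , λ n a≤n → f n (p n a≤n)

lemma2 : (n₁ m k d δ : ℕ → ℕ) →
    BigO (λ n → 2 ^ d n) (λ n → 2 ^ δ n) →
    LittleO (λ n → n) (λ n → δ n * 2 ^ n₁ n) →
    LittleO (λ n → 2 ^ m n) (λ n → δ n * 2 ^ k n * 2 ^ n₁ n) →
    Eventually (λ n → Σ (Table (2 ^ n) (2 ^ n₁ n) (2 ^ m n))
                        (λ E → Balanced (2 ^ k n) (2 ^ d n) (2 ^ δ n) E))
lemma2 n₁ m k d δ (C , n₀ , D≤CΔ) n≪δN₁ M≪δKN₁ =
  eventually-map construct
    (eventually-× (n₀ , D≤CΔ)
      (eventually-× (n≪δN₁ (60 * suc C)) (eventually-× (M≪δKN₁ (30 * suc C)) (1 , λ _ 1≤n → 1≤n))))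
  where
  construct : ∀ n → 2 ^ d n ≤ C * 2 ^ δ n × 60 * suc C * n ≤ δ n * 2 ^ n₁ n
                  × 30 * suc C * 2 ^ m n ≤ δ n * 2 ^ k n * 2 ^ n₁ n × 1 ≤ n →
              Σ (Table (2 ^ n) (2 ^ n₁ n) (2 ^ m n)) (Balanced (2 ^ k n) (2 ^ d n) (2 ^ δ n))
  construct n (D≤CΔ , n≪δN₁ , M≪δKN₁ , 1≤n) =
    Construction.balanced-table n (2 ^ n₁ n) (m n) (k n) (2 ^ d n) (δ n) (suc C)
      1≤n (≤-trans D≤CΔ (*-monoˡ-≤ (2 ^ δ n) (n≤1+n C))) n≪δN₁ M≪δKN₁
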